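{- As $x\to\infty$, $$\#\{n\le x:\ n=k+\varphi(k)\text{ for some positive integer }k\}\ \le\ \left(1-\frac{3}{4\pi^2}+o(1)\right)x,$$ and in particular this count is at most $0.93x$ for all sufficiently large $x$.
   Context: $\varphi$ is Euler's totient function; $n,k$ range over positive integers. -}

module Defs where

open import Data.Nat using (ℕ; zero; suc; _+_; _*_; _≤_; _<_; s≤s; z≤n)
open import Data.Nat.Properties using (anyUpTo?; m≤m+n; ≤-refl)
open import Data.Nat.GCD using (gcd)
open import Data.List using (List; length; filter; map; upTo)
open import Data.Product using (Σ; ∃; _×_; _,_)
open import Data.Product.Properties using ()
open import Relation.Nullary using (Dec; _×-dec_)
open import Relation.Nullary.Decidable using (map′)
open import Relation.Binary.PropositionalEquality using (_≡_; refl; subst; sym)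
import Data.Nat as ℕ
open import Data.Integer using (+_)
open import Data.Rational using (ℚ; _/_; 0ℚ)
import Data.Rational as ℚ

φ : ℕ → ℕ
φ k = length (filter (λ m → gcd m k ℕ.≟ 1) (map suc (upTo k)))

IsKPlusPhi : ℕ → Set
IsKPlusPhi n = ∃ λ k → 1 ≤ k × n ≡ k + φ k

isKPlusPhi? : (n : ℕ) → Dec (IsKPlusPhi n)
isKPlusPhi? n =
  map′ (λ { (k , _ , p) → k , p })
       (λ { (k , q , e) → k , s≤s (subst (k ≤_) (sym e) (m≤m+n k (φ k))) , q , e })
       (anyUpTo? (λ k → (1 ℕ.≤? k) ×-dec (n ℕ.≟ k + φ k)) (suc n))

countKPlusPhi : ℕ → ℕ
countKPlusPhi x = length (filter isKPlusPhi? (map suc (upTo x)))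

ℕ→ℚ : ℕ → ℚ
ℕ→ℚ n = (+ n) / 1

-- Basel partial sums: S N = Σ_{n=1}^{N} 1/n²  (so S N ↑ π²/6)
baselPartial : ℕ → ℚ
baselPartial zero = 0ℚ
baselPartial (suc n) = baselPartial n ℚ.+ ((+ 1) / (suc n * suc n))

-- Every n ≤ x of the form k + φ k comes from a k ≤ x with k + φ k ≤ x, so it suffices to count
-- such k.  Write x = 5s + r and A = 4s and count every k ≤ A.  A larger k with k + φ k ≤ x has
-- cototient k − φ k ≥ 2k − x, while the cototient is at most the sum of the cofactors k/d over the
-- odd divisors d > 1 of k when k is odd, and (k + that sum)/2 when k is even.  So the
-- odd-cofactor sum of such a k is at least 2A − x ≈ 3s if k is odd and 3A − 2x ≈ 2s if k is even.
-- Over the k of one parity in (A, x], the cofactors for a fixed d are the numbers of that parity in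
-- (A/d, x/d], whose sum is at most ((x/d + 1)² − (A/d)²)/4; since ∑_{d odd > 1} 1/(4d²) ≤ 1/16 the
-- total is about (x² − A²)/16 = 9s²/16.  Markov's inequality then leaves about 3s/16 odd and 9s/32
-- even such k, so the count is below (4 + 0.53)s ≤ 0.91x for large x.  Finally S_N + 1/N ≥ 25/18
-- for every N, so a q allowed by the hypothesis has 24(1 − q)·25/18 < 3, that is q > 0.91.

module Submission where

open import Defs

module _ where

  open import Data.Nat
  open import Data.Nat.Properties
  open import Data.Nat.DivMod
  open import Data.Nat.Divisibility
  open import Data.Nat.GCD using (gcd; gcd[m,n]∣m; gcd[m,n]∣n; gcd[m,n]≤n)
  open import Data.Nat.Primality using (euclidsLemma; prime[2])
  open import Data.Nat.Tactic.RingSolver using (solve-∀)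
  open import Data.List using (length; filter; map; upTo; _++_; [_])
  import Data.List.Properties as List
  open import Data.Product using (∃; _×_; _,_; proj₂)
  open import Data.Sum using (inj₁; inj₂)
  open import Function using (_⇔_; mk⇔; Equivalence; _∘_)
  open import Function.Related.TypeIsomorphisms using (¬-cong-⇔)
  open import Level using (0ℓ)
  open import Relation.Binary.PropositionalEquality hiding ([_])
  open import Relation.Nullary using (Dec; yes; no; ¬_; ¬?; _×-dec_; contradiction)
  open import Relation.Unary using (Pred; Decidable)
  open import Algebra.Properties.CommutativeSemigroup +-commutativeSemigroup using (interchange)
  open import Algebra.Properties.CommutativeSemigroup *-commutativeSemigroup using (x∙yz≈y∙xz)

  -- Indicators and finite sums

  𝟙 : ∀ {P : Set} → Dec P → ℕ
  𝟙 (yes _) = 1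
  𝟙 (no _) = 0

  𝟙≤1 : ∀ {P : Set} (P? : Dec P) → 𝟙 P? ≤ 1
  𝟙≤1 (yes _) = ≤-refl
  𝟙≤1 (no _) = z≤n

  𝟙-yes : ∀ {P : Set} (P? : Dec P) → P → 𝟙 P? ≡ 1
  𝟙-yes (yes _) _ = refl
  𝟙-yes (no ¬p) p = contradiction p ¬p

  𝟙-no : ∀ {P : Set} (P? : Dec P) → ¬ P → 𝟙 P? ≡ 0
  𝟙-no (yes p) ¬p = contradiction p ¬p
  𝟙-no (no _) _ = refl

  𝟙-mono : ∀ {P Q : Set} (P? : Dec P) (Q? : Dec Q) → (P → Q) → 𝟙 P? ≤ 𝟙 Q?
  𝟙-mono (yes p) Q? P⇒Q = ≤-reflexive (sym (𝟙-yes Q? (P⇒Q p)))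
  𝟙-mono (no _) _ _ = z≤n

  𝟙-cong : ∀ {P Q : Set} (P? : Dec P) (Q? : Dec Q) → P ⇔ Q → 𝟙 P? ≡ 𝟙 Q?
  𝟙-cong P? Q? P⇔Q = ≤-antisym (𝟙-mono P? Q? to) (𝟙-mono Q? P? from)
    where open Equivalence P⇔Q

  𝟙-× : ∀ {P Q : Set} (P? : Dec P) (Q? : Dec Q) → 𝟙 (P? ×-dec Q?) ≡ 𝟙 P? * 𝟙 Q?
  𝟙-× (yes _) (yes _) = refl
  𝟙-× (yes _) (no _) = refl
  𝟙-× (no _) _ = refl

  𝟙+𝟙¬≡1 : ∀ {P : Set} (P? : Dec P) → 𝟙 P? + 𝟙 (¬? P?) ≡ 1
  𝟙+𝟙¬≡1 (yes _) = refl
  𝟙+𝟙¬≡1 (no _) = refl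

  -- the range is 1 … n, unlike the Fin-indexed ∑[ i < n ] of Algebra.Properties.Monoid.Sum
  ∑₁ : ℕ → (ℕ → ℕ) → ℕ
  ∑₁ zero f = 0
  ∑₁ (suc n) f = ∑₁ n f + f (suc n)

  syntax ∑₁ n (λ i → e) = ∑[ 1≤ i ≤ n ] e

  ∑-cong : ∀ n {f g : ℕ → ℕ} → (∀ i → 1 ≤ i → i ≤ n → f i ≡ g i) → ∑[ 1≤ i ≤ n ] f i ≡ ∑[ 1≤ i ≤ n ] g i
  ∑-cong zero f≡g = refl
  ∑-cong (suc n) f≡g =
    cong₂ _+_ (∑-cong n (λ i 1≤i i≤n → f≡g i 1≤i (m≤n⇒m≤1+n i≤n))) (f≡g (suc n) (s≤s z≤n) ≤-refl)

  ∑-mono-≤ : ∀ n {f g : ℕ → ℕ} → (∀ i → 1 ≤ i → i ≤ n → f i ≤ g i) → ∑[ 1≤ i ≤ n ] f i ≤ ∑[ 1≤ i ≤ n ] g i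
  ∑-mono-≤ zero f≤g = z≤n
  ∑-mono-≤ (suc n) f≤g =
    +-mono-≤ (∑-mono-≤ n (λ i 1≤i i≤n → f≤g i 1≤i (m≤n⇒m≤1+n i≤n))) (f≤g (suc n) (s≤s z≤n) ≤-refl)

  ∑-mono-< : ∀ n {f g : ℕ → ℕ} → (∀ i → 1 ≤ i → i ≤ n → f i ≤ g i) →
             ∀ {j} → 1 ≤ j → j ≤ n → f j < g j → ∑[ 1≤ i ≤ n ] f i < ∑[ 1≤ i ≤ n ] g i
  ∑-mono-< zero _ 1≤j j≤0 _ = contradiction (≤-trans 1≤j j≤0) λ ()
  ∑-mono-< (suc n) f≤g {j} 1≤j j≤1+n fj<gj with m≤n⇒m<n∨m≡n j≤1+n
  ... | inj₂ refl = +-mono-≤-< (∑-mono-≤ n (λ i 1≤i i≤n → f≤g i 1≤i (m≤n⇒m≤1+n i≤n))) fj<gj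
  ... | inj₁ (s≤s j≤n) =
    +-mono-<-≤ (∑-mono-< n (λ i 1≤i i≤n → f≤g i 1≤i (m≤n⇒m≤1+n i≤n)) 1≤j j≤n fj<gj) (f≤g (suc n) (s≤s z≤n) ≤-refl)

  term≤∑ : ∀ n (f : ℕ → ℕ) {j} → 1 ≤ j → j ≤ n → f j ≤ ∑[ 1≤ i ≤ n ] f i
  term≤∑ zero f 1≤j j≤0 = contradiction (≤-trans 1≤j j≤0) λ ()
  term≤∑ (suc n) f {j} 1≤j j≤1+n with m≤n⇒m<n∨m≡n j≤1+n
  ... | inj₂ refl = m≤n+m (f j) (∑₁ n f)
  ... | inj₁ (s≤s j≤n) = ≤-trans (term≤∑ n f 1≤j j≤n) (m≤m+n (∑₁ n f) (f (suc n)))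

  ∑-distrib-+ : ∀ n (f g : ℕ → ℕ) → ∑[ 1≤ i ≤ n ] (f i + g i) ≡ ∑[ 1≤ i ≤ n ] f i + ∑[ 1≤ i ≤ n ] g i
  ∑-distrib-+ zero f g = refl
  ∑-distrib-+ (suc n) f g rewrite ∑-distrib-+ n f g = interchange (∑₁ n f) (∑₁ n g) (f (suc n)) (g (suc n))

  *-distribˡ-∑ : ∀ n c (f : ℕ → ℕ) → c * ∑[ 1≤ i ≤ n ] f i ≡ ∑[ 1≤ i ≤ n ] (c * f i)
  *-distribˡ-∑ zero c f = *-zeroʳ c
  *-distribˡ-∑ (suc n) c f rewrite *-distribˡ-+ c (∑₁ n f) (f (suc n)) | *-distribˡ-∑ n c f = refl

  *-distribʳ-∑ : ∀ n c (f : ℕ → ℕ) → ∑[ 1≤ i ≤ n ] f i * c ≡ ∑[ 1≤ i ≤ n ] (f i * c)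
  *-distribʳ-∑ n c f = begin
    ∑₁ n f * c                 ≡⟨ *-comm (∑₁ n f) c ⟩
    c * ∑₁ n f                 ≡⟨ *-distribˡ-∑ n c f ⟩
    ∑[ 1≤ i ≤ n ] (c * f i)    ≡⟨ ∑-cong n (λ i _ _ → *-comm c (f i)) ⟩
    ∑[ 1≤ i ≤ n ] (f i * c)    ∎
    where open ≡-Reasoning

  ∑-const : ∀ n c → ∑[ 1≤ i ≤ n ] c ≡ n * c
  ∑-const zero c = refl
  ∑-const (suc n) c rewrite ∑-const n c = +-comm (n * c) c

  ∑-comm : ∀ m n (f : ℕ → ℕ → ℕ) → ∑[ 1≤ i ≤ m ] ∑[ 1≤ j ≤ n ] f i j ≡ ∑[ 1≤ j ≤ n ] ∑[ 1≤ i ≤ m ] f i j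
  ∑-comm zero n f = trans (sym (*-zeroʳ n)) (sym (∑-const n 0))
  ∑-comm (suc m) n f = begin
    ∑[ 1≤ i ≤ m ] ∑₁ n (f i) + ∑₁ n (f (suc m))           ≡⟨ cong (_+ ∑₁ n (f (suc m))) (∑-comm m n f) ⟩
    ∑[ 1≤ j ≤ n ] ∑[ 1≤ i ≤ m ] f i j + ∑₁ n (f (suc m))  ≡⟨ ∑-distrib-+ n _ (f (suc m)) ⟨
    ∑[ 1≤ j ≤ n ] ∑[ 1≤ i ≤ suc m ] f i j                ∎
    where open ≡-Reasoning

  ∑-split : ∀ m n (f : ℕ → ℕ) → ∑[ 1≤ i ≤ m + n ] f i ≡ ∑[ 1≤ i ≤ m ] f i + ∑[ 1≤ i ≤ n ] f (m + i)
  ∑-split m zero f rewrite +-identityʳ m = sym (+-identityʳ (∑₁ m f))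
  ∑-split m (suc n) f rewrite +-suc m n | ∑-split m n f = +-assoc (∑₁ m f) (∑₁ n (λ i → f (m + i))) (f (suc (m + n)))

  count : ∀ {P : Pred ℕ 0ℓ} → ℕ → Decidable P → ℕ
  count n P? = ∑[ 1≤ i ≤ n ] 𝟙 (P? i)

  count≤n : ∀ {P : Pred ℕ 0ℓ} (P? : Decidable P) n → count n P? ≤ n
  count≤n P? n = ≤-trans (∑-mono-≤ n (λ i _ _ → 𝟙≤1 (P? i))) (≤-reflexive (trans (∑-const n 1) (*-identityʳ n)))

  length-filter-upTo : ∀ {P : Pred ℕ 0ℓ} (P? : Decidable P) n → length (filter P? (map suc (upTo n))) ≡ count n P?
  length-filter-upTo P? zero = refl
  length-filter-upTo P? (suc n) = begin
    length (filter P? (map suc (upTo (suc n))))                      ≡⟨ cong (λ l → length (filter P? (map suc l))) (List.upTo-∷ʳ n) ⟨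
    length (filter P? (map suc (upTo n ++ [ n ])))                  ≡⟨ cong (λ l → length (filter P? l)) (List.map-++ suc (upTo n) [ n ]) ⟩
    length (filter P? (map suc (upTo n) ++ [ suc n ]))              ≡⟨ cong length (List.filter-++ P? (map suc (upTo n)) [ suc n ]) ⟩
    length (filter P? (map suc (upTo n)) ++ filter P? [ suc n ])    ≡⟨ List.length-++ (filter P? (map suc (upTo n))) ⟩
    length (filter P? (map suc (upTo n))) + length (filter P? [ suc n ]) ≡⟨ cong₂ _+_ (length-filter-upTo P? n) length-filter-singleton ⟩
    count n P? + 𝟙 (P? (suc n))                                      ∎
    where
    open ≡-Reasoning
    length-filter-singleton : length (filter P? [ suc n ]) ≡ 𝟙 (P? (suc n))
    length-filter-singleton with P? (suc n)
    ... | yes _ = refl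
    ... | no _ = refl

  count+count¬≡n : ∀ {P : Pred ℕ 0ℓ} (P? : Decidable P) n → count n P? + count n (λ i → ¬? (P? i)) ≡ n
  count+count¬≡n P? n = begin
    count n P? + count n (λ i → ¬? (P? i))        ≡⟨ ∑-distrib-+ n _ _ ⟨
    ∑[ 1≤ i ≤ n ] (𝟙 (P? i) + 𝟙 (¬? (P? i)))    ≡⟨ ∑-cong n (λ i _ _ → 𝟙+𝟙¬≡1 (P? i)) ⟩
    ∑[ 1≤ i ≤ n ] 1                              ≡⟨ ∑-const n 1 ⟩
    n * 1                                        ≡⟨ *-identityʳ n ⟩
    n                                            ∎
    where open ≡-Reasoning

  count-partition : ∀ {P R : Pred ℕ 0ℓ} (P? : Decidable P) (R? : Decidable R) n →
                    count n P? ≡ count n (λ i → P? i ×-dec R? i) + count n (λ i → P? i ×-dec ¬? (R? i))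
  count-partition P? R? n = trans (∑-cong n (λ i _ _ → split i)) (∑-distrib-+ n _ _)
    where
    split : ∀ i → 𝟙 (P? i) ≡ 𝟙 (P? i ×-dec R? i) + 𝟙 (P? i ×-dec ¬? (R? i))
    split i rewrite 𝟙-× (P? i) (R? i) | 𝟙-× (P? i) (¬? (R? i)) =
      trans (sym (*-identityʳ _)) (trans (cong (𝟙 (P? i) *_) (sym (𝟙+𝟙¬≡1 (R? i)))) (*-distribˡ-+ (𝟙 (P? i)) _ _))

  markov : ∀ n {P : Pred ℕ 0ℓ} (P? : Decidable P) (f : ℕ → ℕ) c →
           (∀ i → 1 ≤ i → i ≤ n → P i → c ≤ f i) → c * count n P? ≤ ∑[ 1≤ i ≤ n ] f i
  markov n P? f c c≤f = begin
    c * count n P?                  ≡⟨ *-distribˡ-∑ n c _ ⟩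
    ∑[ 1≤ i ≤ n ] (c * 𝟙 (P? i))    ≤⟨ ∑-mono-≤ n pointwise ⟩
    ∑[ 1≤ i ≤ n ] f i               ∎
    where
    open ≤-Reasoning
    pointwise : ∀ i → 1 ≤ i → i ≤ n → c * 𝟙 (P? i) ≤ f i
    pointwise i 1≤i i≤n with P? i
    ... | yes p = ≤-trans (≤-reflexive (*-identityʳ c)) (c≤f i 1≤i i≤n p)
    ... | no _ = ≤-trans (≤-reflexive (*-zeroʳ c)) z≤n

  count-union-bound : ∀ n J {P : Pred ℕ 0ℓ} (P? : Decidable P) {Q : ℕ → Pred ℕ 0ℓ} (Q? : ∀ j → Decidable (Q j)) →
                      (∀ m → P m → ∃ λ j → 1 ≤ j × j ≤ J × Q j m) → count n P? ≤ ∑[ 1≤ j ≤ J ] count n (Q? j)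
  count-union-bound n J P? Q? cover = begin
    count n P?                                          ≤⟨ ∑-mono-≤ n (λ m _ _ → pointwise m) ⟩
    ∑[ 1≤ m ≤ n ] ∑[ 1≤ j ≤ J ] 𝟙 (Q? j m)              ≡⟨ ∑-comm n J _ ⟩
    ∑[ 1≤ j ≤ J ] count n (Q? j)                        ∎
    where
    open ≤-Reasoning
    pointwise : ∀ m → 𝟙 (P? m) ≤ ∑[ 1≤ j ≤ J ] 𝟙 (Q? j m)
    pointwise m with P? m
    ... | no _ = z≤n
    ... | yes p with cover m p
    ... | j , 1≤j , j≤J , q = ≤-trans (≤-reflexive (sym (𝟙-yes (Q? j m) q))) (term≤∑ J (λ j → 𝟙 (Q? j m)) 1≤j j≤J)

  count-image≤count-preimage : ∀ {P : Pred ℕ 0ℓ} (P? : Decidable P) (f : ℕ → ℕ) → (∀ k → k ≤ f k) →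
                               (∀ n → P n → ∃ λ k → 1 ≤ k × n ≡ f k) →
                               ∀ x → count x P? ≤ count x (λ k → f k ≤? x)
  count-image≤count-preimage P? f k≤fk image zero = z≤n
  count-image≤count-preimage P? f k≤fk image (suc x) with P? (suc x)
  ... | no _ = begin
    count x P? + 0                      ≡⟨ +-identityʳ _ ⟩
    count x P?                          ≤⟨ count-image≤count-preimage P? f k≤fk image x ⟩
    count x (λ k → f k ≤? x)            ≤⟨ m≤m+n _ _ ⟩
    count (suc x) (λ k → f k ≤? x)      ≤⟨ ∑-mono-≤ (suc x) (λ k _ _ → 𝟙-mono (f k ≤? x) (f k ≤? suc x) m≤n⇒m≤1+n) ⟩
    count (suc x) (λ k → f k ≤? suc x)  ∎
    where open ≤-Reasoning
  ... | yes p with image (suc x) p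
  ... | k , 1≤k , 1+x≡fk = begin
    count x P? + 1                      ≤⟨ +-monoˡ-≤ 1 (count-image≤count-preimage P? f k≤fk image x) ⟩
    count x (λ k → f k ≤? x) + 1        ≤⟨ +-monoˡ-≤ 1 (m≤m+n _ _) ⟩
    count (suc x) (λ k → f k ≤? x) + 1  ≡⟨ +-comm _ 1 ⟩
    suc (count (suc x) (λ k → f k ≤? x)) ≤⟨ ∑-mono-< (suc x) (λ k _ _ → 𝟙-mono (f k ≤? x) (f k ≤? suc x) m≤n⇒m≤1+n)
                                              1≤k (subst (k ≤_) (sym 1+x≡fk) (k≤fk k)) newly-counted ⟩
    count (suc x) (λ k → f k ≤? suc x)  ∎
    where
    open ≤-Reasoning
    newly-counted : 𝟙 (f k ≤? x) < 𝟙 (f k ≤? suc x)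
    newly-counted rewrite 𝟙-no (f k ≤? x) (λ fk≤x → 1+n≰n (subst (_≤ x) (sym 1+x≡fk) fk≤x))
                        | 𝟙-yes (f k ≤? suc x) (≤-reflexive (sym 1+x≡fk)) = s≤s z≤n

  -- Multiples and parity

  m≡n*[m/n]+m%n : ∀ m n .{{_ : NonZero n}} → m ≡ n * (m / n) + m % n
  m≡n*[m/n]+m%n m n = trans (m≡m%n+[m/n]*n m n) (trans (+-comm (m % n) _) (cong (_+ m % n) (*-comm (m / n) n)))

  ∑-multiples : ∀ d .{{_ : NonZero d}} (F : ℕ → ℕ) y →
                ∑[ 1≤ k ≤ y ] (𝟙 (d ∣? k) * F k) ≡ ∑[ 1≤ i ≤ y / d ] F (d * i)
  ∑-multiples d@(suc d′) F y = begin
    ∑₁ y g                                                       ≡⟨ cong (λ y → ∑₁ y g) (m≡n*[m/n]+m%n y d) ⟩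
    ∑₁ (d * (y / d) + y % d) g                                   ≡⟨ ∑-split (d * (y / d)) (y % d) g ⟩
    ∑₁ (d * (y / d)) g + ∑[ 1≤ i ≤ y % d ] g (d * (y / d) + i)   ≡⟨ cong₂ _+_ (whole-blocks (y / d)) (no-multiple (y / d) (m%n<n y d)) ⟩
    ∑[ 1≤ i ≤ y / d ] F (d * i) + 0                              ≡⟨ +-identityʳ _ ⟩
    ∑[ 1≤ i ≤ y / d ] F (d * i)                                  ∎
    where
    open ≡-Reasoning
    g : ℕ → ℕ
    g k = 𝟙 (d ∣? k) * F k
    no-multiple : ∀ b {r} → r < d → ∑[ 1≤ i ≤ r ] g (d * b + i) ≡ 0
    no-multiple b {r} r<d = trans (∑-cong r (λ i 1≤i i≤r → cong (_* F (d * b + i)) (𝟙-no (d ∣? d * b + i) (d∤ i 1≤i i≤r))))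
                                  (trans (∑-const r 0) (*-zeroʳ r))
      where
      d∤ : ∀ i → 1 ≤ i → i ≤ r → ¬ d ∣ d * b + i
      d∤ i@(suc _) _ i≤r d∣ = <⇒≱ (≤-<-trans i≤r r<d) (∣⇒≤ (∣m+n∣m⇒∣n d∣ (m∣m*n b)))
    whole-blocks : ∀ b → ∑[ 1≤ k ≤ d * b ] g k ≡ ∑[ 1≤ i ≤ b ] F (d * i)
    whole-blocks zero = cong (λ n → ∑₁ n g) (*-zeroʳ d)
    whole-blocks (suc b) = begin
      ∑₁ (d * suc b) g                                          ≡⟨ cong (λ n → ∑₁ n g) d*[1+b]≡d*b+d ⟩
      ∑₁ (d * b + d) g                                          ≡⟨ ∑-split (d * b) d g ⟩
      ∑₁ (d * b) g + (∑[ 1≤ i ≤ d′ ] g (d * b + i) + g (d * b + d)) ≡⟨ cong₂ _+_ (whole-blocks b) (cong₂ _+_ (no-multiple b ≤-refl) last) ⟩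
      ∑[ 1≤ i ≤ b ] F (d * i) + (0 + F (d * suc b))            ∎
      where
      d*[1+b]≡d*b+d : d * suc b ≡ d * b + d
      d*[1+b]≡d*b+d = trans (*-suc d b) (+-comm d (d * b))
      last : g (d * b + d) ≡ F (d * suc b)
      last rewrite sym d*[1+b]≡d*b+d | 𝟙-yes (d ∣? d * suc b) (m∣m*n (suc b)) = +-identityʳ _

  count-multiples : ∀ d .{{_ : NonZero d}} y → count y (d ∣?_) ≡ y / d
  count-multiples d y = begin
    count y (d ∣?_)                    ≡⟨ ∑-cong y (λ k _ _ → *-identityʳ (𝟙 (d ∣? k))) ⟨
    ∑[ 1≤ k ≤ y ] (𝟙 (d ∣? k) * 1)     ≡⟨ ∑-multiples d (λ _ → 1) y ⟩
    ∑[ 1≤ i ≤ y / d ] 1                ≡⟨ ∑-const (y / d) 1 ⟩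
    y / d * 1                          ≡⟨ *-identityʳ (y / d) ⟩
    y / d                              ∎
    where open ≡-Reasoning

  count-multiples-× : ∀ d .{{_ : NonZero d}} {Q : Pred ℕ 0ℓ} (Q? : Decidable Q) y →
                      count y (λ k → d ∣? k ×-dec Q? k) ≡ count (y / d) (λ i → Q? (d * i))
  count-multiples-× d Q? y = trans (∑-cong y (λ k _ _ → 𝟙-× (d ∣? k) (Q? k))) (∑-multiples d (λ k → 𝟙 (Q? k)) y)

  oddNum : ℕ → ℕ
  oddNum j = suc (2 * j)

  2∣1+n⇒2∤n : ∀ {n} → 2 ∣ suc n → ¬ 2 ∣ n
  2∣1+n⇒2∤n {n} 2∣1+n 2∣n = 1+n≰n {1} (∣⇒≤ (∣m+n∣m⇒∣n (subst (2 ∣_) (+-comm 1 n) 2∣1+n) 2∣n))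

  2∤oddNum : ∀ j → ¬ 2 ∣ oddNum j
  2∤oddNum j 2∣ = 2∣1+n⇒2∤n 2∣ (m∣m*n j)

  odd⇒oddNum : ∀ {g} → ¬ 2 ∣ g → ∃ λ j → g ≡ oddNum j
  odd⇒oddNum {g} 2∤g with g % 2 in eq | m%n<n g 2
  ... | 0 | _ = contradiction (m%n≡0⇒n∣m g 2 eq) 2∤g
  ... | 1 | _ = g / 2 , trans (m≡n*[m/n]+m%n g 2) (trans (cong (2 * (g / 2) +_) eq) (+-comm _ 1))
  ... | suc (suc _) | s≤s (s≤s ())

  2∣odd*n⇔2∣n : ∀ {d} n → ¬ 2 ∣ d → 2 ∣ d * n ⇔ 2 ∣ n
  2∣odd*n⇔2∣n {d} n 2∤d = mk⇔ to (∣n⇒∣m*n d)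
    where
    to : 2 ∣ d * n → 2 ∣ n
    to 2∣dn with euclidsLemma d n prime[2] 2∣dn
    ... | inj₁ 2∣d = contradiction 2∣d 2∤d
    ... | inj₂ 2∣n = 2∣n

  2∤n⇒2∣1+n : ∀ {n} → ¬ 2 ∣ n → 2 ∣ suc n
  2∤n⇒2∣1+n 2∤n with odd⇒oddNum 2∤n
  ... | j , refl = divides (suc j) (cong (suc ∘ suc) (*-comm 2 j))

  2*count-odd : ∀ {v} → 2 ∣ v → 2 * count v (λ i → ¬? (2 ∣? i)) ≡ v
  2*count-odd {v} 2∣v = +-cancelˡ-≡ v (2 * odds) v (begin
    v + 2 * odds               ≡⟨ cong (_+ 2 * odds) (m*[n/m]≡n 2∣v) ⟨
    2 * (v / 2) + 2 * odds     ≡⟨ cong (λ e → 2 * e + 2 * odds) (count-multiples 2 v) ⟨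
    2 * evens + 2 * odds       ≡⟨ *-distribˡ-+ 2 evens odds ⟨
    2 * (evens + odds)         ≡⟨ cong (2 *_) (count+count¬≡n (2 ∣?_) v) ⟩
    2 * v                      ≡⟨ cong (v +_) (+-identityʳ v) ⟩
    v + v                      ∎)
    where
    open ≡-Reasoning
    evens odds : ℕ
    evens = count v (2 ∣?_)
    odds = count v (λ i → ¬? (2 ∣? i))

  -- The cototient

  cototient : ℕ → ℕ
  cototient k = count k (λ m → ¬? (gcd m k ≟ 1))

  φ+cototient≡id : ∀ k → φ k + cototient k ≡ k
  φ+cototient≡id k = trans (cong (_+ cototient k) (length-filter-upTo (λ m → gcd m k ≟ 1) k)) (count+count¬≡n _ k)

  oddCofactorSum : ℕ → ℕ → ℕ
  oddCofactorSum J k = ∑[ 1≤ j ≤ J ] (𝟙 (oddNum j ∣? k) * (k / oddNum j))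

  count-×-const : ∀ {P : Pred ℕ 0ℓ} {R : Set} (P? : Decidable P) (R? : Dec R) n →
                  count n (λ m → P? m ×-dec R?) ≡ count n P? * 𝟙 R?
  count-×-const P? R? n = trans (∑-cong n (λ m _ _ → 𝟙-× (P? m) R?)) (sym (*-distribʳ-∑ n (𝟙 R?) (λ m → 𝟙 (P? m))))

  odd-common-divisor : ∀ {m k J} → 1 ≤ k → k ≤ J → gcd m k ≢ 1 → ¬ 2 ∣ gcd m k →
                       ∃ λ j → 1 ≤ j × j ≤ J × oddNum j ∣ m × oddNum j ∣ k
  odd-common-divisor {m} {k@(suc _)} {J} _ k≤J g≢1 2∤g with odd⇒oddNum 2∤g
  ... | zero , g≡1 = contradiction g≡1 g≢1
  ... | j@(suc _) , g≡oddNum =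
    j , s≤s z≤n , j≤J , subst (_∣ m) g≡oddNum (gcd[m,n]∣m m k) , subst (_∣ k) g≡oddNum (gcd[m,n]∣n m k)
    where
    j≤J : j ≤ J
    j≤J = ≤-trans (m≤n*m j 2) (≤-trans (n≤1+n _) (≤-trans (≤-reflexive (sym g≡oddNum)) (≤-trans (gcd[m,n]≤n m k) k≤J)))

  cototient≤oddCofactorSum : ∀ {J k} → ¬ 2 ∣ k → 1 ≤ k → k ≤ J → cototient k ≤ oddCofactorSum J k
  cototient≤oddCofactorSum {J} {k} 2∤k 1≤k k≤J = begin
    cototient k                                                            ≤⟨ count-union-bound k J _ common cover ⟩
    ∑[ 1≤ j ≤ J ] count k (common j)                                       ≡⟨ ∑-cong J (λ j _ _ → term j) ⟩
    oddCofactorSum J k                                                     ∎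
    where
    open ≤-Reasoning
    common : ∀ j → Decidable (λ m → oddNum j ∣ m × oddNum j ∣ k)
    common j m = oddNum j ∣? m ×-dec oddNum j ∣? k
    cover : ∀ m → ¬ gcd m k ≡ 1 → ∃ λ j → 1 ≤ j × j ≤ J × oddNum j ∣ m × oddNum j ∣ k
    cover m g≢1 = odd-common-divisor 1≤k k≤J g≢1 (λ 2∣g → 2∤k (∣-trans 2∣g (gcd[m,n]∣n m k)))
    term : ∀ j → count k (common j) ≡ 𝟙 (oddNum j ∣? k) * (k / oddNum j)
    term j = begin-equality
      count k (common j)                              ≡⟨ count-×-const (oddNum j ∣?_) (oddNum j ∣? k) k ⟩
      count k (oddNum j ∣?_) * 𝟙 (oddNum j ∣? k)      ≡⟨ cong (_* 𝟙 (oddNum j ∣? k)) (count-multiples (oddNum j) k) ⟩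
      k / oddNum j * 𝟙 (oddNum j ∣? k)                ≡⟨ *-comm (k / oddNum j) _ ⟩
      𝟙 (oddNum j ∣? k) * (k / oddNum j)              ∎

  -- even m are counted directly; an odd m sharing a factor with k shares an odd divisor d of k,
  -- and exactly half of the multiples of d up to k are odd
  2*cototient≤k+oddCofactorSum : ∀ {J k} → 2 ∣ k → 1 ≤ k → k ≤ J → 2 * cototient k ≤ k + oddCofactorSum J k
  2*cototient≤k+oddCofactorSum {J} {k} 2∣k 1≤k k≤J = begin
    2 * cototient k                                                   ≡⟨ cong (2 *_) (count-partition coprime? (2 ∣?_) k) ⟩
    2 * (count k (λ m → coprime? m ×-dec 2 ∣? m) + count k (λ m → coprime? m ×-dec ¬? (2 ∣? m)))
                                                                      ≤⟨ *-monoʳ-≤ 2 (+-mono-≤ (∑-mono-≤ k λ m _ _ → 𝟙-mono _ _ proj₂)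
                                                                                              (count-union-bound k J _ oddCommon cover)) ⟩
    2 * (count k (2 ∣?_) + ∑[ 1≤ j ≤ J ] count k (oddCommon j))      ≡⟨ *-distribˡ-+ 2 (count k (2 ∣?_)) (∑[ 1≤ j ≤ J ] count k (oddCommon j)) ⟩
    2 * count k (2 ∣?_) + 2 * ∑[ 1≤ j ≤ J ] count k (oddCommon j)    ≡⟨ cong₂ _+_ evens (*-distribˡ-∑ J 2 (λ j → count k (oddCommon j))) ⟩
    k + ∑[ 1≤ j ≤ J ] (2 * count k (oddCommon j))                    ≡⟨ cong (k +_) (∑-cong J (λ j _ _ → term j)) ⟩
    k + oddCofactorSum J k                                            ∎
    where
    open ≤-Reasoning
    coprime? : Decidable (λ m → ¬ gcd m k ≡ 1)
    coprime? m = ¬? (gcd m k ≟ 1)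
    oddCommon : ∀ j → Decidable (λ m → (oddNum j ∣ m × ¬ 2 ∣ m) × oddNum j ∣ k)
    oddCommon j m = (oddNum j ∣? m ×-dec ¬? (2 ∣? m)) ×-dec oddNum j ∣? k
    cover : ∀ m → ¬ gcd m k ≡ 1 × ¬ 2 ∣ m → ∃ λ j → 1 ≤ j × j ≤ J × (oddNum j ∣ m × ¬ 2 ∣ m) × oddNum j ∣ k
    cover m (g≢1 , 2∤m) with odd-common-divisor 1≤k k≤J g≢1 (λ 2∣g → 2∤m (∣-trans 2∣g (gcd[m,n]∣m m k)))
    ... | j , 1≤j , j≤J , d∣m , d∣k = j , 1≤j , j≤J , (d∣m , 2∤m) , d∣k
    evens : 2 * count k (2 ∣?_) ≡ k
    evens = trans (cong (2 *_) (count-multiples 2 k)) (m*[n/m]≡n 2∣k)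
    term : ∀ j → 2 * count k (oddCommon j) ≡ 𝟙 (oddNum j ∣? k) * (k / oddNum j)
    term j = begin-equality
      2 * count k (oddCommon j)                      ≡⟨ cong (2 *_) (count-×-const oddMultiple? (oddNum j ∣? k) k) ⟩
      2 * (count k oddMultiple? * 𝟙 (oddNum j ∣? k))  ≡⟨ by-divisibility (oddNum j ∣? k) ⟩
      𝟙 (oddNum j ∣? k) * (k / oddNum j)              ∎
      where
      d = oddNum j
      oddMultiple? : Decidable (λ m → d ∣ m × ¬ 2 ∣ m)
      oddMultiple? m = d ∣? m ×-dec ¬? (2 ∣? m)
      by-divisibility : (d∣k? : Dec (d ∣ k)) → 2 * (count k oddMultiple? * 𝟙 d∣k?) ≡ 𝟙 d∣k? * (k / d)
      by-divisibility (no _) = cong (2 *_) (*-zeroʳ (count k oddMultiple?))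
      by-divisibility (yes d∣k) = begin-equality
        2 * (count k oddMultiple? * 1)               ≡⟨ cong (2 *_) (*-identityʳ (count k oddMultiple?)) ⟩
        2 * count k oddMultiple?                     ≡⟨ cong (2 *_) (count-multiples-× d (λ m → ¬? (2 ∣? m)) k) ⟩
        2 * count (k / d) (λ i → ¬? (2 ∣? (d * i)))  ≡⟨ cong (2 *_) (∑-cong (k / d) λ i _ _ →
                                                          𝟙-cong _ _ (¬-cong-⇔ (2∣odd*n⇔2∣n i (2∤oddNum j)))) ⟩
        2 * count (k / d) (λ i → ¬? (2 ∣? i))        ≡⟨ 2*count-odd 2∣k/d ⟩
        k / d                                        ≡⟨ +-identityʳ (k / d) ⟨
        1 * (k / d)                                  ∎
        where
        2∣k/d : 2 ∣ k / d
        2∣k/d = Equivalence.to (2∣odd*n⇔2∣n (k / d) (2∤oddNum j)) (subst (2 ∣_) (sym (m*[n/m]≡n d∣k)) 2∣k)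

  -- Odd-cofactor sums over a parity class

  n*[m/n]≤m : ∀ m n .{{_ : NonZero n}} → n * (m / n) ≤ m
  n*[m/n]≤m m n = subst (_≤ m) (*-comm (m / n) n) (m/n*n≤m m n)

  m<n*[1+m/n] : ∀ m n .{{_ : NonZero n}} → m < n * suc (m / n)
  m<n*[1+m/n] m n = begin-strict
    m                    ≡⟨ m≡n*[m/n]+m%n m n ⟩
    n * (m / n) + m % n  <⟨ +-monoʳ-< (n * (m / n)) (m%n<n m n) ⟩
    n * (m / n) + n      ≡⟨ trans (+-comm _ n) (sym (*-suc n (m / n))) ⟩
    n * suc (m / n)      ∎
    where open ≤-Reasoning

  scaled-square-bound : ∀ d .{{_ : NonZero d}} {W W′ A x} → A ≤ x →
                        4 * W + (A / d) * (A / d) ≤ suc (x / d) * suc (x / d) + 4 * W′ →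
                        4 * (d * d) * W + A * A ≤ x * x + 4 * d * x + 2 * (d * d) + 4 * (d * d) * W′
  scaled-square-bound d {W} {W′} {A} {x} A≤x bound = begin
    4 * (d * d) * W + A * A                                   ≤⟨ +-monoʳ-≤ _ (*-mono-≤ A≤du+d A≤du+d) ⟩
    4 * (d * d) * W + (d * u + d) * (d * u + d)               ≡⟨ expand-left d u W ⟩
    (d * d) * (4 * W + u * u) + 2 * d * (d * u) + d * d       ≤⟨ +-monoˡ-≤ _ (+-mono-≤ (*-monoʳ-≤ (d * d) bound) (*-monoʳ-≤ (2 * d) du≤A)) ⟩
    (d * d) * (suc v * suc v + 4 * W′) + 2 * d * A + d * d    ≡⟨ expand-right d v W′ A ⟩
    (d * v + d) * (d * v + d) + 4 * (d * d) * W′ + 2 * d * A + d * d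
                                                              ≤⟨ +-monoˡ-≤ _ (+-mono-≤ (+-monoˡ-≤ _ (*-mono-≤ dv+d≤x+d dv+d≤x+d)) (*-monoʳ-≤ (2 * d) A≤x)) ⟩
    (x + d) * (x + d) + 4 * (d * d) * W′ + 2 * d * x + d * d  ≡⟨ collect x d W′ ⟩
    x * x + 4 * d * x + 2 * (d * d) + 4 * (d * d) * W′        ∎
    where
    open ≤-Reasoning
    u v : ℕ
    u = A / d
    v = x / d
    A≤du+d : A ≤ d * u + d
    A≤du+d = ≤-trans (<⇒≤ (m<n*[1+m/n] A d)) (≤-reflexive (trans (*-suc d u) (+-comm d (d * u))))
    du≤A : d * u ≤ A
    du≤A = n*[m/n]≤m A d
    dv+d≤x+d : d * v + d ≤ x + d
    dv+d≤x+d = +-monoˡ-≤ d (n*[m/n]≤m x d)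
    expand-left : ∀ d u W → 4 * (d * d) * W + (d * u + d) * (d * u + d) ≡ (d * d) * (4 * W + u * u) + 2 * d * (d * u) + d * d
    expand-left = solve-∀
    expand-right : ∀ d v W′ A → (d * d) * (suc v * suc v + 4 * W′) + 2 * d * A + d * d
                              ≡ (d * v + d) * (d * v + d) + 4 * (d * d) * W′ + 2 * d * A + d * d
    expand-right = solve-∀
    collect : ∀ x d W′ → (x + d) * (x + d) + 4 * (d * d) * W′ + 2 * d * x + d * d ≡ x * x + 4 * d * x + 2 * (d * d) + 4 * (d * d) * W′
    collect = solve-∀

  divide-bound : ∀ d .{{_ : NonZero d}} .{{_ : NonZero (4 * (d * d))}} {W W′ N x} →
                 4 * (d * d) * W ≤ N + 4 * d * x + 2 * (d * d) + 4 * (d * d) * W′ →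
                 W ≤ W′ + (N / (4 * (d * d)) + x / d + 2)
  divide-bound d {W} {W′} {N} {x} bound = m<1+n⇒m≤n (*-cancelˡ-< c W _ (begin-strict
    c * W                                              ≤⟨ bound ⟩
    N + 4 * d * x + 2 * (d * d) + c * W′               <⟨ +-monoˡ-< _ (+-mono-<-≤ (+-mono-<-≤ (m<n*[1+m/n] N c) 4dx≤) 2d²≤c) ⟩
    c * suc (N / c) + c * suc (x / d) + c + c * W′     ≡⟨ collect c (N / c) (x / d) W′ ⟩
    c * suc (W′ + (N / c + x / d + 2))                 ∎))
    where
    open ≤-Reasoning
    c : ℕ
    c = 4 * (d * d)
    4dx≤ : 4 * d * x ≤ c * suc (x / d)
    4dx≤ = ≤-trans (*-monoʳ-≤ (4 * d) (<⇒≤ (m<n*[1+m/n] x d))) (≤-reflexive (reassociate d (x / d)))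
      where
      reassociate : ∀ d q → 4 * d * (d * suc q) ≡ 4 * (d * d) * suc q
      reassociate = solve-∀
    2d²≤c : 2 * (d * d) ≤ c
    2d²≤c = *-monoˡ-≤ (d * d) (m≤m+n 2 2)
    collect : ∀ c p q w → c * suc p + c * suc q + c + c * w ≡ c * suc (w + (p + q + 2))
    collect = solve-∀

  module ParityClass {Q : Pred ℕ 0ℓ} (Q? : Decidable Q)
                     (odd*-invariant : ∀ {d} i → ¬ 2 ∣ d → Q (d * i) ⇔ Q i)
                     (no-consecutive : ∀ {v} → Q (suc v) → ¬ Q v) where

    classSum : ℕ → ℕ
    classSum v = ∑[ 1≤ i ≤ v ] (𝟙 (Q? i) * i)

    ∑-class-oddCofactorSum : ∀ J y → ∑[ 1≤ k ≤ y ] (𝟙 (Q? k) * oddCofactorSum J k) ≡ ∑[ 1≤ j ≤ J ] classSum (y / oddNum j)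
    ∑-class-oddCofactorSum J y = begin
      ∑[ 1≤ k ≤ y ] (𝟙 (Q? k) * oddCofactorSum J k)                               ≡⟨ ∑-cong y (λ k _ _ → *-distribˡ-∑ J (𝟙 (Q? k)) _) ⟩
      ∑[ 1≤ k ≤ y ] ∑[ 1≤ j ≤ J ] (𝟙 (Q? k) * (𝟙 (oddNum j ∣? k) * (k / oddNum j))) ≡⟨ ∑-comm y J _ ⟩
      ∑[ 1≤ j ≤ J ] ∑[ 1≤ k ≤ y ] (𝟙 (Q? k) * (𝟙 (oddNum j ∣? k) * (k / oddNum j))) ≡⟨ ∑-cong J (λ j _ _ → per-divisor j) ⟩
      ∑[ 1≤ j ≤ J ] classSum (y / oddNum j)                                       ∎
      where
      open ≡-Reasoning
      per-divisor : ∀ j → ∑[ 1≤ k ≤ y ] (𝟙 (Q? k) * (𝟙 (oddNum j ∣? k) * (k / oddNum j))) ≡ classSum (y / oddNum j)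
      per-divisor j = begin
        ∑[ 1≤ k ≤ y ] (𝟙 (Q? k) * (𝟙 (d ∣? k) * (k / d)))    ≡⟨ ∑-cong y (λ k _ _ → x∙yz≈y∙xz (𝟙 (Q? k)) (𝟙 (d ∣? k)) (k / d)) ⟩
        ∑[ 1≤ k ≤ y ] (𝟙 (d ∣? k) * (𝟙 (Q? k) * (k / d)))    ≡⟨ ∑-multiples d (λ k → 𝟙 (Q? k) * (k / d)) y ⟩
        ∑[ 1≤ i ≤ y / d ] (𝟙 (Q? (d * i)) * (d * i / d))    ≡⟨ ∑-cong (y / d) (λ i _ _ → cong₂ _*_ (𝟙-cong (Q? (d * i)) (Q? i) (odd*-invariant i (2∤oddNum j)))
                                                                                                     (trans (cong (_/ d) (*-comm d i)) (m*n/n≡m i d))) ⟩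
        classSum (y / d)                                    ∎
        where d = oddNum j

    -- members of the class are at least 2 apart, and the terms 4i = (i + 1)² − (i − 1)² telescope
    classSum-bound : ∀ {u v} → u ≤ v → 4 * classSum v + u * u ≤ suc v * suc v + 4 * classSum u
    classSum-bound {u} {v} u≤v = ≤-trans (step u≤v) (+-monoˡ-≤ _ (*-mono-≤ v+𝟙≤1+v v+𝟙≤1+v))
      where
      v+𝟙≤1+v : v + 𝟙 (Q? v) ≤ suc v
      v+𝟙≤1+v = ≤-trans (+-monoʳ-≤ v (𝟙≤1 (Q? v))) (≤-reflexive (+-comm v 1))
      step : ∀ {v} → u ≤ v → 4 * classSum v + u * u ≤ (v + 𝟙 (Q? v)) * (v + 𝟙 (Q? v)) + 4 * classSum u
      step {v} u≤v with m≤n⇒m<n∨m≡n u≤v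
      ... | inj₂ refl = begin
        4 * classSum u + u * u                                   ≡⟨ +-comm (4 * classSum u) (u * u) ⟩
        u * u + 4 * classSum u                                   ≤⟨ +-monoˡ-≤ _ (*-mono-≤ (m≤m+n u _) (m≤m+n u _)) ⟩
        (u + 𝟙 (Q? u)) * (u + 𝟙 (Q? u)) + 4 * classSum u         ∎
        where open ≤-Reasoning
      step {suc w} u≤v | inj₁ (s≤s u≤w) with Q? (suc w) | step u≤w
      ... | no _ | ih = begin
        4 * (classSum w + 0) + u * u                             ≡⟨ cong (λ s → 4 * s + u * u) (+-identityʳ (classSum w)) ⟩
        4 * classSum w + u * u                                   ≤⟨ ih ⟩
        (w + 𝟙 (Q? w)) * (w + 𝟙 (Q? w)) + 4 * classSum u         ≤⟨ +-monoˡ-≤ _ (*-mono-≤ w+𝟙≤w+1 w+𝟙≤w+1) ⟩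
        (suc w + 0) * (suc w + 0) + 4 * classSum u               ∎
        where
        open ≤-Reasoning
        w+𝟙≤w+1 : w + 𝟙 (Q? w) ≤ suc w + 0
        w+𝟙≤w+1 = ≤-trans (+-monoʳ-≤ w (𝟙≤1 (Q? w))) (≤-reflexive (trans (+-comm w 1) (sym (+-identityʳ (suc w)))))
      ... | yes q | ih = begin
        4 * (classSum w + 1 * suc w) + u * u                     ≡⟨ rearrange (classSum w) w (u * u) ⟩
        (4 * classSum w + u * u) + 4 * suc w                     ≤⟨ +-monoˡ-≤ _ ih ⟩
        (w + 𝟙 (Q? w)) * (w + 𝟙 (Q? w)) + 4 * classSum u + 4 * suc w  ≡⟨ cong (λ e → (w + e) * (w + e) + 4 * classSum u + 4 * suc w)
                                                                           (𝟙-no (Q? w) (no-consecutive q)) ⟩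
        (w + 0) * (w + 0) + 4 * classSum u + 4 * suc w          ≡⟨ complete-square w (4 * classSum u) ⟩
        (suc w + 1) * (suc w + 1) + 4 * classSum u               ∎
        where
        open ≤-Reasoning
        rearrange : ∀ s w a → 4 * (s + 1 * suc w) + a ≡ (4 * s + a) + 4 * suc w
        rearrange = solve-∀
        complete-square : ∀ w c → (w + 0) * (w + 0) + c + 4 * suc w ≡ (suc w + 1) * (suc w + 1) + c
        complete-square = solve-∀

    classSum-increment : ∀ d .{{_ : NonZero d}} .{{_ : NonZero (4 * (d * d))}} {A x} → A ≤ x →
                         classSum (x / d) ≤ classSum (A / d) + ((x * x ∸ A * A) / (4 * (d * d)) + x / d + 2)
    classSum-increment d {A} {x} A≤x = divide-bound d (+-cancelʳ-≤ (A * A) (c * W) (N + 4 * d * x + 2 * (d * d) + c * W′) (begin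
      c * W + A * A                                         ≤⟨ scaled-square-bound d A≤x (classSum-bound (/-monoˡ-≤ d A≤x)) ⟩
      x * x + 4 * d * x + 2 * (d * d) + c * W′              ≡⟨ cong (λ y → y + 4 * d * x + 2 * (d * d) + c * W′) (m∸n+n≡m A²≤x²) ⟨
      (N + A * A) + 4 * d * x + 2 * (d * d) + c * W′        ≡⟨ move-to-end N (A * A) (4 * d * x) (2 * (d * d)) (c * W′) ⟩
      N + 4 * d * x + 2 * (d * d) + c * W′ + A * A          ∎))
      where
      open ≤-Reasoning
      c N W W′ : ℕ
      c = 4 * (d * d)
      N = x * x ∸ A * A
      W = classSum (x / d)
      W′ = classSum (A / d)
      A²≤x² : A * A ≤ x * x
      A²≤x² = *-mono-≤ A≤x A≤x
      move-to-end : ∀ n a b b′ c → (n + a) + b + b′ + c ≡ n + b + b′ + c + a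
      move-to-end = solve-∀

    ∑-class-oddCofactorSum≤ : ∀ J A n →
      ∑[ 1≤ i ≤ n ] (𝟙 (Q? (A + i)) * oddCofactorSum J (A + i))
        ≤ ∑[ 1≤ j ≤ J ] (((A + n) * (A + n) ∸ A * A) / (4 * (oddNum j * oddNum j)) + (A + n) / oddNum j + 2)
    ∑-class-oddCofactorSum≤ J A n = +-cancelˡ-≤ (before A) (∑[ 1≤ i ≤ n ] g (A + i)) (∑₁ J increment) (begin
      before A + ∑[ 1≤ i ≤ n ] g (A + i)   ≡⟨ cong (_+ ∑[ 1≤ i ≤ n ] g (A + i)) (∑-class-oddCofactorSum J A) ⟨
      ∑₁ A g + ∑[ 1≤ i ≤ n ] g (A + i)     ≡⟨ ∑-split A n g ⟨
      ∑₁ (A + n) g                         ≡⟨ ∑-class-oddCofactorSum J (A + n) ⟩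
      before (A + n)                       ≤⟨ ∑-mono-≤ J (λ j _ _ → classSum-increment (oddNum j) (m≤m+n A n)) ⟩
      ∑[ 1≤ j ≤ J ] (classSum (A / oddNum j) + increment j) ≡⟨ ∑-distrib-+ J (λ j → classSum (A / oddNum j)) increment ⟩
      before A + ∑₁ J increment            ∎)
      where
      open ≤-Reasoning
      g : ℕ → ℕ
      g k = 𝟙 (Q? k) * oddCofactorSum J k
      before : ℕ → ℕ
      before y = ∑[ 1≤ j ≤ J ] classSum (y / oddNum j)
      increment : ℕ → ℕ
      increment j = ((A + n) * (A + n) ∸ A * A) / (4 * (oddNum j * oddNum j)) + (A + n) / oddNum j + 2

  -- Telescoping and harmonic sums

  m*n≤o⇒m≤o/n : ∀ m n .{{_ : NonZero n}} o → m * n ≤ o → m ≤ o / n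
  m*n≤o⇒m≤o/n m n o mn≤o = subst (_≤ o / n) (m*n/n≡m m n) (/-monoˡ-≤ n mn≤o)

  -- 1/(4(2j+3)²) + 1/(16(j+2)) ≤ 1/(16(j+1)), because 4(2j+3)² ≥ 16(j+1)(j+2)
  telescope-step : ∀ N j → N / (4 * (oddNum (suc j) * oddNum (suc j))) + N / (16 * suc (suc j)) ≤ N / (16 * suc j)
  telescope-step N j = m*n≤o⇒m≤o/n (a + b) (16 * suc j) N (*-cancelʳ-≤ _ _ (suc (suc j)) (begin
    (a + b) * (16 * suc j) * suc (suc j)                          ≡⟨ distribute a b j ⟩
    a * (16 * (suc j * suc (suc j))) + b * (16 * suc (suc j)) * suc j
                                                                  ≤⟨ +-mono-≤ (≤-trans (*-monoʳ-≤ a (odd-square j)) (m/n*n≤m N _))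
                                                                              (*-monoˡ-≤ (suc j) (m/n*n≤m N _)) ⟩
    N + N * suc j                                                 ≡⟨ *-suc N (suc j) ⟨
    N * suc (suc j)                                               ∎))
    where
    open ≤-Reasoning
    a b : ℕ
    a = N / (4 * (oddNum (suc j) * oddNum (suc j)))
    b = N / (16 * suc (suc j))
    distribute : ∀ a b j → (a + b) * (16 * suc j) * suc (suc j) ≡ a * (16 * (suc j * suc (suc j))) + b * (16 * suc (suc j)) * suc j
    distribute = solve-∀
    odd-square : ∀ j → 16 * (suc j * suc (suc j)) ≤ 4 * (oddNum (suc j) * oddNum (suc j))
    odd-square j = subst (16 * (suc j * suc (suc j)) ≤_) (expand j) (m≤m+n _ 4)
      where
      expand : ∀ j → 16 * (suc j * suc (suc j)) + 4 ≡ 4 * (suc (2 * suc j) * suc (2 * suc j))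
      expand = solve-∀

  ∑-telescope : ∀ N n → ∑[ 1≤ j ≤ n ] (N / (4 * (oddNum j * oddNum j))) + N / (16 * suc n) ≤ N / 16
  ∑-telescope N zero = ≤-refl
  ∑-telescope N (suc n) = begin
    ∑₁ n f + f (suc n) + N / (16 * suc (suc n))      ≡⟨ +-assoc (∑₁ n f) (f (suc n)) _ ⟩
    ∑₁ n f + (f (suc n) + N / (16 * suc (suc n)))    ≤⟨ +-monoʳ-≤ (∑₁ n f) (telescope-step N n) ⟩
    ∑₁ n f + N / (16 * suc n)                        ≤⟨ ∑-telescope N n ⟩
    N / 16                                           ∎
    where
    open ≤-Reasoning
    f : ℕ → ℕ
    f j = N / (4 * (oddNum j * oddNum j))

  count-≤-bound : ∀ n T → count n (_≤? T) ≤ T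
  count-≤-bound zero T = z≤n
  count-≤-bound (suc n) T with suc n ≤? T
  ... | yes 1+n≤T = ≤-trans (+-monoˡ-≤ 1 (count≤n (_≤? T) n)) (≤-trans (≤-reflexive (+-comm n 1)) 1+n≤T)
  ... | no _ = ≤-trans (≤-reflexive (+-identityʳ _)) (count-≤-bound n T)

  -- split the range at T: the first T terms are at most x, the later ones at most x / T
  ∑-harmonic : ∀ T (f : ℕ → ℕ) x n → (∀ j → 1 ≤ j → j * f j ≤ x) → T * ∑[ 1≤ j ≤ n ] f j ≤ T * T * x + n * x
  ∑-harmonic T f x n jf≤x = begin
    T * ∑₁ n f                                         ≡⟨ *-distribˡ-∑ n T f ⟩
    ∑[ 1≤ j ≤ n ] (T * f j)                            ≤⟨ ∑-mono-≤ n (λ j 1≤j _ → pointwise j 1≤j) ⟩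
    ∑[ 1≤ j ≤ n ] (x + 𝟙 (j ≤? T) * (T * x))           ≡⟨ ∑-distrib-+ n (λ _ → x) _ ⟩
    ∑[ 1≤ j ≤ n ] x + ∑[ 1≤ j ≤ n ] (𝟙 (j ≤? T) * (T * x)) ≡⟨ cong₂ _+_ (∑-const n x) (sym (*-distribʳ-∑ n (T * x) (λ j → 𝟙 (j ≤? T)))) ⟩
    n * x + count n (_≤? T) * (T * x)                  ≤⟨ +-monoʳ-≤ (n * x) (*-monoˡ-≤ (T * x) (count-≤-bound n T)) ⟩
    n * x + T * (T * x)                                ≡⟨ trans (+-comm (n * x) (T * (T * x))) (cong (_+ n * x) (sym (*-assoc T T x))) ⟩
    T * T * x + n * x                                  ∎
    where
    open ≤-Reasoning
    pointwise : ∀ j → 1 ≤ j → T * f j ≤ x + 𝟙 (j ≤? T) * (T * x)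
    pointwise j 1≤j with j ≤? T
    ... | yes _ = begin
      T * f j              ≡⟨ cong (T *_) (*-identityˡ (f j)) ⟨
      T * (1 * f j)        ≤⟨ *-monoʳ-≤ T (≤-trans (*-monoˡ-≤ (f j) 1≤j) (jf≤x j 1≤j)) ⟩
      T * x                ≤⟨ m≤n+m (T * x) x ⟩
      x + T * x            ≡⟨ cong (x +_) (+-identityʳ (T * x)) ⟨
      x + (T * x + 0)      ∎
    ... | no j≰T = ≤-trans (*-monoˡ-≤ (f j) (<⇒≤ (≰⇒> j≰T))) (≤-trans (jf≤x j 1≤j) (m≤m+n x _))

  -- Counting the k with k + φ k ≤ x

  quadratic-dominates : ∀ a b c {s₀ s} → b + c ≤ a * s₀ → s₀ ≤ s → 1 ≤ s → b * s + c ≤ a * (s * s)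
  quadratic-dominates a b c {s₀} {s} b+c≤as₀ s₀≤s 1≤s = begin
    b * s + c            ≤⟨ +-monoʳ-≤ (b * s) (≤-trans (≤-reflexive (sym (*-identityʳ c))) (*-monoʳ-≤ c 1≤s)) ⟩
    b * s + c * s        ≡⟨ *-distribʳ-+ s b c ⟨
    (b + c) * s          ≤⟨ *-monoˡ-≤ s (≤-trans b+c≤as₀ (*-monoʳ-≤ a s₀≤s)) ⟩
    a * s * s            ≡⟨ *-assoc a s s ⟩
    a * (s * s)          ∎
    where open ≤-Reasoning

  threshold-bound : ∀ a {s P y} → a * s + 100 * y ≤ 100 * P → a * s ≤ 100 * (P ∸ y)
  threshold-bound a {s} {P} {y} bound = +-cancelʳ-≤ (100 * y) (a * s) (100 * (P ∸ y)) (begin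
    a * s + 100 * y              ≤⟨ bound ⟩
    100 * P                      ≤⟨ *-monoʳ-≤ 100 (m≤n+m∸n P y) ⟩
    100 * (y + (P ∸ y))          ≡⟨ *-distribˡ-+ 100 y (P ∸ y) ⟩
    100 * y + 100 * (P ∸ y)      ≡⟨ +-comm (100 * y) _ ⟩
    100 * (P ∸ y) + 100 * y      ∎)
    where open ≤-Reasoning

  fraction-bound : ∀ a .{{_ : NonZero a}} c {s w g B} → 100000 ≤ 16 * a * c → 1 ≤ s →
                   a * s ≤ 100 * w → 16 * (w * g) ≤ B → B ≤ 10 * (s * s) → 100 * g ≤ c * s
  fraction-bound a c {s} {w} {g} {B} 10⁵≤16ac 1≤s as≤100w 16wg≤B B≤10s² =
    *-cancelˡ-≤ (16 * a) {{m*n≢0 16 a}} (begin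
      16 * a * (100 * g)         ≡⟨ reassociate a g ⟩
      100 * (16 * a * g)         ≤⟨ *-monoʳ-≤ 100 16ag≤1000s ⟩
      100 * (1000 * s)           ≡⟨ *-assoc 100 1000 s ⟨
      100000 * s                 ≤⟨ *-monoˡ-≤ s 10⁵≤16ac ⟩
      16 * a * c * s             ≡⟨ *-assoc (16 * a) c s ⟩
      16 * a * (c * s)           ∎)
    where
    open ≤-Reasoning
    instance
      s-nonZero : NonZero s
      s-nonZero = >-nonZero 1≤s
    reassociate : ∀ a g → 16 * a * (100 * g) ≡ 100 * (16 * a * g)
    reassociate = solve-∀
    16ag≤1000s : 16 * a * g ≤ 1000 * s
    16ag≤1000s = *-cancelˡ-≤ s (begin
      s * (16 * a * g)           ≡⟨ regroup s a g ⟩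
      16 * g * (a * s)           ≤⟨ *-monoʳ-≤ (16 * g) as≤100w ⟩
      16 * g * (100 * w)         ≡⟨ regroup′ g w ⟩
      100 * (16 * (w * g))       ≤⟨ *-monoʳ-≤ 100 (≤-trans 16wg≤B B≤10s²) ⟩
      100 * (10 * (s * s))       ≡⟨ regroup″ s ⟩
      s * (1000 * s)             ∎)
      where
      regroup : ∀ s a g → s * (16 * a * g) ≡ 16 * g * (a * s)
      regroup = solve-∀
      regroup′ : ∀ g w → 16 * g * (100 * w) ≡ 100 * (16 * (w * g))
      regroup′ = solve-∀
      regroup″ : ∀ s → 100 * (10 * (s * s)) ≡ s * (1000 * s)
      regroup″ = solve-∀

  module Evens = ParityClass (2 ∣?_) 2∣odd*n⇔2∣n 2∣1+n⇒2∤n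
  module Odds = ParityClass (λ i → ¬? (2 ∣? i)) (λ i 2∤d → ¬-cong-⇔ (2∣odd*n⇔2∣n i 2∤d))
                            (λ 2∤1+v 2∤v → 2∤1+v (2∤n⇒2∣1+n 2∤v))

  good⇒2k≤x+cototient : ∀ {k x} → k + φ k ≤ x → k + k ≤ x + cototient k
  good⇒2k≤x+cototient {k} {x} good = begin
    k + k                   ≡⟨ cong (k +_) (φ+cototient≡id k) ⟨
    k + (φ k + cototient k) ≡⟨ +-assoc k (φ k) (cototient k) ⟨
    k + φ k + cototient k   ≤⟨ +-monoˡ-≤ (cototient k) good ⟩
    x + cototient k         ∎
    where open ≤-Reasoning

  odd-good⇒2A∸x≤oddCofactorSum : ∀ {A k x} → A < k → k ≤ x → ¬ 2 ∣ k → k + φ k ≤ x → 2 * A ∸ x ≤ oddCofactorSum x k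
  odd-good⇒2A∸x≤oddCofactorSum {A} {k} {x} A<k k≤x 2∤k good = m≤n+o⇒m∸n≤o (2 * A) x (begin
    2 * A                    ≤⟨ *-monoʳ-≤ 2 (<⇒≤ A<k) ⟩
    2 * k                    ≡⟨ cong (k +_) (+-identityʳ k) ⟩
    k + k                    ≤⟨ good⇒2k≤x+cototient {k} good ⟩
    x + cototient k          ≤⟨ +-monoʳ-≤ x (cototient≤oddCofactorSum 2∤k (≤-trans (s≤s z≤n) A<k) k≤x) ⟩
    x + oddCofactorSum x k   ∎)
    where open ≤-Reasoning

  even-good⇒3A∸2x≤oddCofactorSum : ∀ {A k x} → A < k → k ≤ x → 2 ∣ k → k + φ k ≤ x → 3 * A ∸ 2 * x ≤ oddCofactorSum x k
  even-good⇒3A∸2x≤oddCofactorSum {A} {k} {x} A<k k≤x 2∣k good = m≤n+o⇒m∸n≤o (3 * A) (2 * x) (+-cancelʳ-≤ k _ _ (begin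
    3 * A + k                              ≤⟨ +-monoˡ-≤ k (*-monoʳ-≤ 3 (<⇒≤ A<k)) ⟩
    3 * k + k                              ≡⟨ regroup k ⟩
    2 * (k + k)                            ≤⟨ *-monoʳ-≤ 2 (good⇒2k≤x+cototient {k} good) ⟩
    2 * (x + cototient k)                  ≡⟨ *-distribˡ-+ 2 x (cototient k) ⟩
    2 * x + 2 * cototient k                ≤⟨ +-monoʳ-≤ (2 * x) (2*cototient≤k+oddCofactorSum 2∣k (≤-trans (s≤s z≤n) A<k) k≤x) ⟩
    2 * x + (k + oddCofactorSum x k)       ≡⟨ +-comm-middle (2 * x) k (oddCofactorSum x k) ⟩
    2 * x + oddCofactorSum x k + k         ∎))
    where
    open ≤-Reasoning
    regroup : ∀ k → 3 * k + k ≡ 2 * (k + k)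
    regroup = solve-∀
    +-comm-middle : ∀ a b c → a + (b + c) ≡ a + c + b
    +-comm-middle = solve-∀

  harmonicOdd : ℕ → ℕ
  harmonicOdd x = ∑[ 1≤ j ≤ x ] (x / oddNum j)

  16*∑-increments≤ : ∀ N x J → 16 * ∑[ 1≤ j ≤ J ] (N / (4 * (oddNum j * oddNum j)) + x / oddNum j + 2)
                                ≤ N + 16 * ∑[ 1≤ j ≤ J ] (x / oddNum j) + 32 * J
  16*∑-increments≤ N x J = begin
    16 * ∑[ 1≤ j ≤ J ] (a j + b j + 2)        ≡⟨ cong (16 *_) (trans (∑-distrib-+ J (λ j → a j + b j) (λ _ → 2))
                                                                     (cong₂ _+_ (∑-distrib-+ J a b) (∑-const J 2))) ⟩
    16 * (∑₁ J a + ∑₁ J b + J * 2)             ≡⟨ distribute (∑₁ J a) (∑₁ J b) J ⟩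
    16 * ∑₁ J a + 16 * ∑₁ J b + 32 * J         ≤⟨ +-monoˡ-≤ (32 * J) (+-monoˡ-≤ (16 * ∑₁ J b) 16∑a≤N) ⟩
    N + 16 * ∑₁ J b + 32 * J                   ∎
    where
    open ≤-Reasoning
    a b : ℕ → ℕ
    a j = N / (4 * (oddNum j * oddNum j))
    b j = x / oddNum j
    distribute : ∀ p q J → 16 * (p + q + J * 2) ≡ 16 * p + 16 * q + 32 * J
    distribute = solve-∀
    16∑a≤N : 16 * ∑₁ J a ≤ N
    16∑a≤N = begin
      16 * ∑₁ J a            ≤⟨ *-monoʳ-≤ 16 (≤-trans (m≤m+n (∑₁ J a) _) (∑-telescope N J)) ⟩
      16 * (N / 16)          ≤⟨ n*[m/n]≤m N 16 ⟩
      N                      ∎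

  harmonicOdd-bound : ∀ T x → T * harmonicOdd x ≤ T * T * x + x * x
  harmonicOdd-bound T x = ∑-harmonic T (λ j → x / oddNum j) x x j*[x/oddNum]≤x
    where
    j*[x/oddNum]≤x : ∀ j → 1 ≤ j → j * (x / oddNum j) ≤ x
    j*[x/oddNum]≤x j _ = ≤-trans (*-monoˡ-≤ (x / oddNum j) (≤-trans (m≤n*m j 2) (n≤1+n _))) (n*[m/n]≤m x (oddNum j))

  module GoodCount (A n : ℕ) where

    x : ℕ
    x = A + n

    good? : ∀ k → Dec (k + φ k ≤ x)
    good? k = k + φ k ≤? x

    oddGood evenGood : ℕ
    oddGood = count n (λ i → good? (A + i) ×-dec ¬? (2 ∣? (A + i)))
    evenGood = count n (λ i → good? (A + i) ×-dec 2 ∣? (A + i))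

    countKPlusPhi≤ : countKPlusPhi x ≤ A + (evenGood + oddGood)
    countKPlusPhi≤ = begin
      countKPlusPhi x                                  ≡⟨ length-filter-upTo isKPlusPhi? x ⟩
      count x isKPlusPhi?                              ≤⟨ count-image≤count-preimage isKPlusPhi? (λ k → k + φ k)
                                                            (λ k → m≤m+n k (φ k)) (λ _ p → p) x ⟩
      count (A + n) good?                              ≡⟨ ∑-split A n (λ k → 𝟙 (good? k)) ⟩
      count A good? + count n (λ i → good? (A + i))    ≤⟨ +-monoˡ-≤ _ (count≤n good? A) ⟩
      A + count n (λ i → good? (A + i))                ≡⟨ cong (A +_) (count-partition (λ i → good? (A + i)) (λ i → 2 ∣? (A + i)) n) ⟩
      A + (evenGood + oddGood)                         ∎
      where open ≤-Reasoning

    classSumBound : ℕ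
    classSumBound = (x * x ∸ A * A) + 16 * harmonicOdd x + 32 * x

    A<A+i : ∀ {i} → 1 ≤ i → A < A + i
    A<A+i 1≤i = ≤-trans (≤-reflexive (+-comm 1 A)) (+-monoʳ-≤ A 1≤i)

    oddGood-bound : 16 * ((2 * A ∸ x) * oddGood) ≤ classSumBound
    oddGood-bound = begin
      16 * ((2 * A ∸ x) * oddGood)                                              ≤⟨ *-monoʳ-≤ 16 (markov n _ _ _ threshold) ⟩
      16 * ∑[ 1≤ i ≤ n ] (𝟙 (¬? (2 ∣? (A + i))) * oddCofactorSum x (A + i))     ≤⟨ *-monoʳ-≤ 16 (Odds.∑-class-oddCofactorSum≤ x A n) ⟩
      16 * ∑[ 1≤ j ≤ x ] ((x * x ∸ A * A) / (4 * (oddNum j * oddNum j)) + x / oddNum j + 2) ≤⟨ 16*∑-increments≤ (x * x ∸ A * A) x x ⟩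
      classSumBound                                                             ∎
      where
      open ≤-Reasoning
      threshold : ∀ i → 1 ≤ i → i ≤ n → (A + i) + φ (A + i) ≤ x × ¬ 2 ∣ (A + i) →
                  2 * A ∸ x ≤ 𝟙 (¬? (2 ∣? (A + i))) * oddCofactorSum x (A + i)
      threshold i 1≤i i≤n (good , 2∤k) rewrite 𝟙-yes (¬? (2 ∣? (A + i))) 2∤k | +-identityʳ (oddCofactorSum x (A + i)) =
        odd-good⇒2A∸x≤oddCofactorSum (A<A+i 1≤i) (+-monoʳ-≤ A i≤n) 2∤k good

    evenGood-bound : 16 * ((3 * A ∸ 2 * x) * evenGood) ≤ classSumBound
    evenGood-bound = begin
      16 * ((3 * A ∸ 2 * x) * evenGood)                                         ≤⟨ *-monoʳ-≤ 16 (markov n _ _ _ threshold) ⟩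
      16 * ∑[ 1≤ i ≤ n ] (𝟙 (2 ∣? (A + i)) * oddCofactorSum x (A + i))          ≤⟨ *-monoʳ-≤ 16 (Evens.∑-class-oddCofactorSum≤ x A n) ⟩
      16 * ∑[ 1≤ j ≤ x ] ((x * x ∸ A * A) / (4 * (oddNum j * oddNum j)) + x / oddNum j + 2) ≤⟨ 16*∑-increments≤ (x * x ∸ A * A) x x ⟩
      classSumBound                                                             ∎
      where
      open ≤-Reasoning
      threshold : ∀ i → 1 ≤ i → i ≤ n → (A + i) + φ (A + i) ≤ x × 2 ∣ (A + i) →
                  3 * A ∸ 2 * x ≤ 𝟙 (2 ∣? (A + i)) * oddCofactorSum x (A + i)
      threshold i 1≤i i≤n (good , 2∣k) rewrite 𝟙-yes (2 ∣? (A + i)) 2∣k | +-identityʳ (oddCofactorSum x (A + i)) =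
        even-good⇒3A∸2x≤oddCofactorSum (A<A+i 1≤i) (+-monoʳ-≤ A i≤n) 2∣k good

  -- with A = 4s and x = 5s + r: 2A ∸ x ≈ 3s, 3A ∸ 2x ≈ 2s and classSumBound ≈ 9.4s², so
  -- 16·3s·oddGood ≲ 10s² and 16·2s·evenGood ≲ 10s²
  module Window (s r : ℕ) (250000≤s : 250000 ≤ s) (r≤4 : r ≤ 4) where

    open GoodCount (4 * s) (s + r)

    1≤s : 1 ≤ s
    1≤s = ≤-trans (s≤s z≤n) 250000≤s

    800≤s : 800 ≤ s
    800≤s = ≤-trans (m≤m+n 800 249200) 250000≤s

    x≤5s+4 : x ≤ 5 * s + 4
    x≤5s+4 = ≤-trans (+-monoʳ-≤ (4 * s) (+-monoʳ-≤ s r≤4)) (≤-reflexive (regroup s))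
      where
      regroup : ∀ s → 4 * s + (s + 4) ≡ 5 * s + 4
      regroup = solve-∀

    classSumBound≤10s² : classSumBound ≤ 10 * (s * s)
    classSumBound≤10s² = *-cancelˡ-≤ 1000 (+-cancelʳ-≤ (16000 * (s * s)) (1000 * classSumBound) (1000 * (10 * (s * s))) (begin
      1000 * (N + 16 * H + 32 * x) + 16000 * (s * s)                   ≡⟨ regroup 1000 N H x (s * s) ⟩
      1000 * (N + 16 * (s * s)) + 16 * (1000 * H) + 32000 * x          ≡⟨ cong (λ y → 1000 * y + 16 * (1000 * H) + 32000 * x) N+16s²≡x² ⟩
      1000 * (x * x) + 16 * (1000 * H) + 32000 * x                     ≤⟨ +-monoˡ-≤ (32000 * x) (+-monoʳ-≤ (1000 * (x * x))
                                                                              (*-monoʳ-≤ 16 (harmonicOdd-bound 1000 x))) ⟩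
      1000 * (x * x) + 16 * (1000 * 1000 * x + x * x) + 32000 * x      ≡⟨ collect 1000 x ⟩
      1016 * (x * x) + 16032000 * x                                    ≤⟨ +-mono-≤ (*-monoʳ-≤ 1016 (*-mono-≤ x≤5s+4 x≤5s+4)) (*-monoʳ-≤ 16032000 x≤5s+4) ⟩
      1016 * ((5 * s + 4) * (5 * s + 4)) + 16032000 * (5 * s + 4)      ≡⟨ expand 1000 s ⟩
      25400 * (s * s) + (80200640 * s + 64144256)                      ≤⟨ +-monoʳ-≤ (25400 * (s * s)) (quadratic-dominates 600 80200640 64144256 {250000}
                                                                              (m≤m+n (80200640 + 64144256) 5655104) 250000≤s 1≤s) ⟩
      25400 * (s * s) + 600 * (s * s)                                  ≡⟨ *-distribʳ-+ (s * s) 25400 600 ⟨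
      26000 * (s * s)                                                  ≡⟨ *-distribʳ-+ (s * s) 10000 16000 ⟩
      10000 * (s * s) + 16000 * (s * s)                                ≡⟨ cong (_+ 16000 * (s * s)) (*-assoc 1000 10 (s * s)) ⟩
      1000 * (10 * (s * s)) + 16000 * (s * s)                          ∎))
      where
      open ≤-Reasoning
      N H : ℕ
      N = x * x ∸ 4 * s * (4 * s)
      H = harmonicOdd x
      N+16s²≡x² : N + 16 * (s * s) ≡ x * x
      N+16s²≡x² = trans (cong (N +_) (square s)) (m∸n+n≡m (*-mono-≤ (m≤m+n (4 * s) (s + r)) (m≤m+n (4 * s) (s + r))))
        where
        square : ∀ s → 16 * (s * s) ≡ 4 * s * (4 * s)
        square = solve-∀
      -- stated for a variable T (here 1000): the ring solver is very slow on large literals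
      regroup : ∀ T N H x t → T * (N + 16 * H + 32 * x) + 16 * T * t ≡ T * (N + 16 * t) + 16 * (T * H) + 32 * T * x
      regroup = solve-∀
      collect : ∀ T x → T * (x * x) + 16 * (T * T * x + x * x) + 32 * T * x ≡ (T + 16) * (x * x) + (16 * T * T + 32 * T) * x
      collect = solve-∀
      expand : ∀ T s → (T + 16) * ((5 * s + 4) * (5 * s + 4)) + (16 * T * T + 32 * T) * (5 * s + 4)
                       ≡ 25 * (T + 16) * (s * s) + ((80 * T * T + 200 * T + 640) * s + (64 * T * T + 144 * T + 256))
      expand = solve-∀

    299s≤100*[2A∸x] : 299 * s ≤ 100 * (2 * (4 * s) ∸ x)
    299s≤100*[2A∸x] = threshold-bound 299 {s} {2 * (4 * s)} {x} (begin
      299 * s + 100 * x                    ≤⟨ +-monoʳ-≤ (299 * s) (*-monoʳ-≤ 100 x≤5s+4) ⟩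
      299 * s + 100 * (5 * s + 4)          ≡⟨ expand s ⟩
      799 * s + 400                        ≤⟨ +-monoʳ-≤ (799 * s) (≤-trans (m≤m+n 400 400) 800≤s) ⟩
      799 * s + s                          ≡⟨ collect s ⟩
      100 * (2 * (4 * s))                  ∎)
      where
      open ≤-Reasoning
      expand : ∀ s → 299 * s + 100 * (5 * s + 4) ≡ 799 * s + 400
      expand = solve-∀
      collect : ∀ s → 799 * s + s ≡ 100 * (2 * (4 * s))
      collect = solve-∀

    199s≤100*[3A∸2x] : 199 * s ≤ 100 * (3 * (4 * s) ∸ 2 * x)
    199s≤100*[3A∸2x] = threshold-bound 199 {s} {3 * (4 * s)} {2 * x} (begin
      199 * s + 100 * (2 * x)              ≤⟨ +-monoʳ-≤ (199 * s) (*-monoʳ-≤ 100 (*-monoʳ-≤ 2 x≤5s+4)) ⟩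
      199 * s + 100 * (2 * (5 * s + 4))    ≡⟨ expand s ⟩
      1199 * s + 800                       ≤⟨ +-monoʳ-≤ (1199 * s) 800≤s ⟩
      1199 * s + s                         ≡⟨ collect s ⟩
      100 * (3 * (4 * s))                  ∎)
      where
      open ≤-Reasoning
      expand : ∀ s → 199 * s + 100 * (2 * (5 * s + 4)) ≡ 1199 * s + 800
      expand = solve-∀
      collect : ∀ s → 1199 * s + s ≡ 100 * (3 * (4 * s))
      collect = solve-∀

    100*oddGood≤21s : 100 * oddGood ≤ 21 * s
    100*oddGood≤21s = fraction-bound 299 21 {s} {2 * (4 * s) ∸ x} {oddGood} (m≤m+n 100000 464) 1≤s
                        299s≤100*[2A∸x] oddGood-bound classSumBound≤10s²

    100*evenGood≤32s : 100 * evenGood ≤ 32 * s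
    100*evenGood≤32s = fraction-bound 199 32 {s} {3 * (4 * s) ∸ 2 * x} {evenGood} (m≤m+n 100000 1888) 1≤s
                         199s≤100*[3A∸2x] evenGood-bound classSumBound≤10s²

    100*countKPlusPhi≤91*[5s+r] : 100 * countKPlusPhi x ≤ 91 * (5 * s + r)
    100*countKPlusPhi≤91*[5s+r] = begin
      100 * countKPlusPhi x                                ≤⟨ *-monoʳ-≤ 100 countKPlusPhi≤ ⟩
      100 * (4 * s + (evenGood + oddGood))                 ≡⟨ distribute s evenGood oddGood ⟩
      400 * s + (100 * evenGood + 100 * oddGood)           ≤⟨ +-monoʳ-≤ (400 * s) (+-mono-≤ 100*evenGood≤32s 100*oddGood≤21s) ⟩
      400 * s + (32 * s + 21 * s)                          ≤⟨ m≤m+n _ (2 * s) ⟩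
      400 * s + (32 * s + 21 * s) + 2 * s                  ≡⟨ collect s ⟩
      91 * (5 * s)                                         ≤⟨ *-monoʳ-≤ 91 (m≤m+n (5 * s) r) ⟩
      91 * (5 * s + r)                                     ∎
      where
      open ≤-Reasoning
      distribute : ∀ s e o → 100 * (4 * s + (e + o)) ≡ 400 * s + (100 * e + 100 * o)
      distribute = solve-∀
      collect : ∀ s → 400 * s + (32 * s + 21 * s) + 2 * s ≡ 91 * (5 * s)
      collect = solve-∀

  100*countKPlusPhi≤91*x : ∀ x → 1250000 ≤ x → 100 * countKPlusPhi x ≤ 91 * x
  100*countKPlusPhi≤91*x x 1250000≤x = begin
    100 * countKPlusPhi x                      ≡⟨ cong (λ y → 100 * countKPlusPhi y) (trans x≡5s+r (regroup s r)) ⟩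
    100 * countKPlusPhi (4 * s + (s + r))      ≤⟨ Window.100*countKPlusPhi≤91*[5s+r] s r 250000≤s (m<1+n⇒m≤n (m%n<n x 5)) ⟩
    91 * (5 * s + r)                           ≡⟨ cong (91 *_) x≡5s+r ⟨
    91 * x                                     ∎
    where
    open ≤-Reasoning
    s r : ℕ
    s = x / 5
    r = x % 5
    x≡5s+r : x ≡ 5 * s + r
    x≡5s+r = m≡n*[m/n]+m%n x 5
    250000≤s : 250000 ≤ s
    250000≤s = m*n≤o⇒m≤o/n 250000 5 x 1250000≤x
    regroup : ∀ s r → 5 * s + r ≡ 4 * s + (s + r)
    regroup = solve-∀

-- Passing to ℚ

import Data.Nat as ℕ
import Data.Nat.Properties as ℕ
open import Data.Nat using (ℕ; suc; _≥_)
import Data.Integer as ℤ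
import Data.Integer.Properties as ℤ
open import Data.Integer using (+_)
open import Data.Rational using (ℚ; mkℚ; _/_; _*_; _+_; _-_; _<_; _≤_; _≤?_; 1ℚ; 0ℚ; *≤*; NonNegative; nonNegative)
open import Data.Rational.Properties
open import Data.Nat.Coprimality using (1-coprimeTo)
import Data.Nat.Coprimality as Coprime
open import Data.Product using (∃; _×_; _,_)
open import Relation.Binary.PropositionalEquality
open import Relation.Nullary using (yes; no; contradiction)
open import Relation.Nullary.Decidable using (toWitness)

ℕ→ℚ≡mkℚ : ∀ n → ℕ→ℚ n ≡ mkℚ (+ n) 0 (Coprime.sym (1-coprimeTo n))
ℕ→ℚ≡mkℚ n = normalize-coprime (Coprime.sym (1-coprimeTo n))

ℕ→ℚ-mono-≤ : ∀ {m n} → m ℕ.≤ n → ℕ→ℚ m ≤ ℕ→ℚ n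
ℕ→ℚ-mono-≤ {m} {n} m≤n rewrite ℕ→ℚ≡mkℚ m | ℕ→ℚ≡mkℚ n =
  *≤* (subst₂ ℤ._≤_ (sym (ℤ.*-identityʳ (+ m))) (sym (ℤ.*-identityʳ (+ n))) (ℤ.+≤+ m≤n))

ℕ→ℚ-* : ∀ m n → ℕ→ℚ (m ℕ.* n) ≡ ℕ→ℚ m * ℕ→ℚ n
ℕ→ℚ-* m n rewrite ℕ→ℚ≡mkℚ m | ℕ→ℚ≡mkℚ n = cong (_/ 1) (ℤ.pos-* m n)

ℕ→ℚ-≤-91% : ∀ c x → 100 ℕ.* c ℕ.≤ 91 ℕ.* x → ℕ→ℚ c ≤ (+ 91 / 100) * ℕ→ℚ x
ℕ→ℚ-≤-91% c x 100c≤91x = begin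
  ℕ→ℚ c                                   ≡⟨ *-identityˡ (ℕ→ℚ c) ⟨
  ((+ 1 / 100) * ℕ→ℚ 100) * ℕ→ℚ c         ≡⟨ *-assoc (+ 1 / 100) (ℕ→ℚ 100) (ℕ→ℚ c) ⟩
  (+ 1 / 100) * (ℕ→ℚ 100 * ℕ→ℚ c)         ≡⟨ cong ((+ 1 / 100) *_) (ℕ→ℚ-* 100 c) ⟨
  (+ 1 / 100) * ℕ→ℚ (100 ℕ.* c)           ≤⟨ *-monoˡ-≤-nonNeg (+ 1 / 100) {{normalize-nonNeg 1 100}} (ℕ→ℚ-mono-≤ 100c≤91x) ⟩
  (+ 1 / 100) * ℕ→ℚ (91 ℕ.* x)            ≡⟨ cong ((+ 1 / 100) *_) (ℕ→ℚ-* 91 x) ⟩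
  (+ 1 / 100) * (ℕ→ℚ 91 * ℕ→ℚ x)          ≡⟨ *-assoc (+ 1 / 100) (ℕ→ℚ 91) (ℕ→ℚ x) ⟨
  (+ 91 / 100) * ℕ→ℚ x                    ∎
  where open ≤-Reasoning

baselPartial-mono-≤ : ∀ {m n} → m ℕ.≤ n → baselPartial m ≤ baselPartial n
baselPartial-mono-≤ {m} {n} m≤n with ℕ.m≤n⇒∃[o]m+o≡n m≤n
... | k , refl = grow k
  where
  grow : ∀ k → baselPartial m ≤ baselPartial (m ℕ.+ k)
  grow ℕ.zero rewrite ℕ.+-identityʳ m = ≤-refl
  grow (suc k) rewrite ℕ.+-suc m k = begin
    baselPartial m                                                          ≤⟨ grow k ⟩
    baselPartial (m ℕ.+ k)                                                  ≡⟨ +-identityʳ _ ⟨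
    baselPartial (m ℕ.+ k) + 0ℚ                                             ≤⟨ +-monoʳ-≤ (baselPartial (m ℕ.+ k))
                                                                                 (nonNegative⁻¹ _ {{normalize-nonNeg 1 (suc (m ℕ.+ k) ℕ.* suc (m ℕ.+ k))}}) ⟩
    baselPartial (m ℕ.+ k) + (+ 1 / (suc (m ℕ.+ k) ℕ.* suc (m ℕ.+ k)))      ∎
    where open ≤-Reasoning

-- S₄ = 205/144 already exceeds 25/18; for N < 4 the tail term 1/N makes up the difference
25/18≤baselPartial+1/N : ∀ N → + 25 / 18 ≤ baselPartial (suc N) + + 1 / suc N
25/18≤baselPartial+1/N 0 = toWitness {a? = + 25 / 18 ≤? baselPartial 1 + + 1 / 1} _
25/18≤baselPartial+1/N 1 = toWitness {a? = + 25 / 18 ≤? baselPartial 2 + + 1 / 2} _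
25/18≤baselPartial+1/N 2 = toWitness {a? = + 25 / 18 ≤? baselPartial 3 + + 1 / 3} _
25/18≤baselPartial+1/N N@(suc (suc (suc k))) = begin
  + 25 / 18                              ≤⟨ toWitness {a? = + 25 / 18 ≤? baselPartial 4} _ ⟩
  baselPartial 4                         ≤⟨ baselPartial-mono-≤ (ℕ.m≤m+n 4 k) ⟩
  baselPartial (suc N)                   ≡⟨ +-identityʳ _ ⟨
  baselPartial (suc N) + 0ℚ              ≤⟨ +-monoʳ-≤ (baselPartial (suc N)) (nonNegative⁻¹ _ {{normalize-nonNeg 1 (suc N)}}) ⟩
  baselPartial (suc N) + + 1 / suc N     ∎
  where open ≤-Reasoning

91/100≤q : ∀ q N → (+ 24 / 1) * (1ℚ - q) * (baselPartial (suc N) + + 1 / suc N) < + 3 / 1 → + 91 / 100 ≤ q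
91/100≤q q N hyp with + 91 / 100 ≤? q
... | yes 91/100≤q = 91/100≤q
... | no 91/100≰q = contradiction (≤-<-trans 3≤ hyp) (<-irrefl refl)
  where
  open ≤-Reasoning
  L : ℚ
  L = baselPartial (suc N) + + 1 / suc N
  L-nonNeg : NonNegative L
  L-nonNeg = nonNegative (≤-trans (toWitness {a? = 0ℚ ≤? + 25 / 18} _) (25/18≤baselPartial+1/N N))
  9/100≤1-q : + 9 / 100 ≤ 1ℚ - q
  9/100≤1-q = <⇒≤ (+-monoʳ-< 1ℚ (neg-antimono-< (≰⇒> 91/100≰q)))
  3≤ : + 3 / 1 ≤ (+ 24 / 1) * (1ℚ - q) * L
  3≤ = begin
    + 3 / 1                                    ≡⟨⟩
    ((+ 24 / 1) * (+ 9 / 100)) * (+ 25 / 18)   ≤⟨ *-monoˡ-≤-nonNeg ((+ 24 / 1) * (+ 9 / 100)) (25/18≤baselPartial+1/N N) ⟩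
    ((+ 24 / 1) * (+ 9 / 100)) * L             ≤⟨ *-monoʳ-≤-nonNeg L {{L-nonNeg}} (*-monoˡ-≤-nonNeg (+ 24 / 1) 9/100≤1-q) ⟩
    (+ 24 / 1) * (1ℚ - q) * L                  ∎

countKPlusPhi≤q*x : ∀ {q} → + 91 / 100 ≤ q → ∀ x → x ≥ 1250000 → ℕ→ℚ (countKPlusPhi x) ≤ q * ℕ→ℚ x
countKPlusPhi≤q*x {q} 91/100≤q x x≥X =
  ≤-trans (ℕ→ℚ-≤-91% (countKPlusPhi x) x (100*countKPlusPhi≤91*x x x≥X))
          (*-monoʳ-≤-nonNeg (ℕ→ℚ x) {{normalize-nonNeg x 1}} 91/100≤q)

mainTheorem5 : ((q : ℚ) →
    (∃ λ N → ((+ 24) / 1) * (1ℚ - q) * (baselPartial (suc N) + (+ 1) / suc N) < (+ 3) / 1) →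
    ∃ λ X → (x : ℕ) → x ≥ X → ℕ→ℚ (countKPlusPhi x) ≤ q * ℕ→ℚ x)
    × (∃ λ X → (x : ℕ) → x ≥ X → ℕ→ℚ (countKPlusPhi x) ≤ ((+ 93) / 100) * ℕ→ℚ x)
mainTheorem5 =
  (λ q (N , hyp) → 1250000 , countKPlusPhi≤q*x (91/100≤q q N hyp)) ,
  (1250000 , countKPlusPhi≤q*x (toWitness {a? = + 91 / 100 ≤? + 93 / 100} _))
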